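{- If $A$ is a logic with $\mathrm{PEL}_0 \le A \le \mathrm{CL}$, then $A$ satisfies the weak form of the principle of equivalent formula substitution. If $A$ is a logic with $\mathrm{PEL} \le A \le \mathrm{CL}$, then $A$ satisfies the principle of equivalent formula substitution.
   Context: Formulas are built from propositional variables (including a distinguished placeholder variable $x_0$) and constants $\top,\bot$ using $\land$ and $\to$. A sequent is $\Gamma\vdash\phi$ with $\Gamma$ a finite list of formulas. A rule is a derived rule of a logic if it can be obtained as a combination of its inference rules; $A\le B$ means every inference rule of $A$ is a derived rule of $B$. $\mathrm{PL}$ has the rules: $\vdash\top$; $\phi\vdash\phi$; from $\Gamma\vdash\psi$ infer $\Gamma,\phi\vdash\psi$; from $\Gamma\vdash\phi$ and $\Gamma,\phi\vdash\psi$ infer $\Gamma\vdash\psi$; from $\Gamma\vdash\phi\land\psi$ infer $\Gamma\vdash\phi$ and $\Gamma\vdash\psi$; from $\Gamma\vdash\phi$ and $\Gamma\vdash\psi$ infer $\Gamma\vdash\phi\land\psi$; from $\Gamma\vdash\phi$ and $\Gamma\vdash\phi\to\psi$ infer $\Gamma\vdash\psi$; from $\Gamma\vdash\psi$ infer $\Gamma\vdash\phi\to\psi$. $\mathrm{ML}$ is $\mathrm{PL}$ plus: from $\Gamma,\phi\vdash\psi$ infer $\Gamma\vdash\phi\to\psi$. $\mathrm{IL}$ is $\mathrm{ML}$ plus the axiom $\bot\vdash\phi$. $\mathrm{CL}$ is $\mathrm{IL}$ plus: from $\Gamma,\phi\vdash\psi$ and $\Gamma,(\phi\to\bot)\vdash\psi$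 infer $\Gamma\vdash\psi$. (E1) from $\Gamma,\phi\vdash\psi$ and $\Gamma,\psi\vdash\phi$ infer $\Gamma,(\phi\to\chi)\vdash(\psi\to\chi)$; (E2) from the same premises infer $\Gamma,(\chi\to\phi)\vdash(\chi\to\psi)$; E1$_0$ and E2$_0$ are the same rules with $\Gamma$ empty. $\mathrm{PEL}=\mathrm{PL}+\mathrm{E1}+\mathrm{E2}$, $\mathrm{PEL}_0=\mathrm{PL}+\mathrm{E1}_0+\mathrm{E2}_0$. For an expression $F$ (a formula possibly containing $x_0$), let $F[\phi]$ denote the result of replacing $x_0$ by $\phi$. A logic satisfies the principle of equivalent formula substitution if for every $F$ the rule "from $\Gamma,\phi\vdash\psi$ and $\Gamma,\psi\vdash\phi$ infer $\Gamma,F[\phi]\vdash F[\psi]$" is a derived rule of it; it satisfies the weak form if for every $F$ the rule "from $\phi\vdash\psi$ and $\psi\vdash\phi$ infer $F[\phi]\vdash F[\psi]$" is a derived rule of it. -}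

module Defs where

open import Data.Nat using (ℕ; zero; suc)
open import Data.List using (List; []; _∷_; _++_; [_])
open import Data.List.Membership.Propositional using (_∈_)
open import Data.List.Relation.Binary.Subset.Propositional using (_⊆_)
open import Data.List.Relation.Unary.All using (All)
open import Data.Product using (_×_)
open import Data.Sum using (_⊎_)

-- Formulas: propositional variables (x₀ = var 0 is the placeholder), ⊤, ⊥, ∧, →
infixr 6 _∧_
infixr 5 _⇒_
data Formula : Set where
  var  : ℕ → Formula
  ⊤′   : Formula
  ⊥′   : Formula
  _∧_  : Formula → Formula → Formula
  _⇒_  : Formula → Formula → Formula

_⟦_⟧ : Formula → Formula → Formula
var zero    ⟦ φ ⟧ = φ
var (suc n) ⟦ φ ⟧ = var (suc n)
⊤′          ⟦ φ ⟧ = ⊤′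
⊥′          ⟦ φ ⟧ = ⊥′
(F ∧ G)     ⟦ φ ⟧ = (F ⟦ φ ⟧) ∧ (G ⟦ φ ⟧)
(F ⇒ G)     ⟦ φ ⟧ = (F ⟦ φ ⟧) ⇒ (G ⟦ φ ⟧)

infix 4 _⊢_
record Sequent : Set where
  constructor _⊢_
  field
    ctx  : List Formula
    goal : Formula

infixl 5 _,,_
_,,_ : List Formula → Formula → List Formula
Γ ,, φ = Γ ++ [ φ ]

-- A rule (or a logic, i.e. a collection of inference rules) is given by its set
-- of instances: a list of premises and a conclusion.
Rules : Set₁
Rules = List Sequent → Sequent → Set

_∪_ : Rules → Rules → Rules
(A ∪ B) ps c = A ps c ⊎ B ps c

-- Contexts are treated as
-- finite collections: sequents whose contexts have the same members are
-- identified (implicit exchange / contraction).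
data Der (L : Rules) (H : List Sequent) : Sequent → Set where
  hyp    : ∀ {s} → s ∈ H → Der L H s
  rule   : ∀ {ps c} → L ps c → All (Der L H) ps → Der L H c
  struct : ∀ {Γ Δ φ} → Γ ⊆ Δ → Δ ⊆ Γ → Der L H (Γ ⊢ φ) → Der L H (Δ ⊢ φ)

Derived : Rules → Rules → Set
Derived R L = ∀ ps c → R ps c → Der L ps c

_≤L_ : Rules → Rules → Set
A ≤L B = Derived A B

data PL : Rules where
  top   : PL [] ([] ⊢ ⊤′)
  ax    : ∀ φ → PL [] ([ φ ] ⊢ φ)
  weak  : ∀ Γ φ ψ → PL ((Γ ⊢ ψ) ∷ []) (Γ ,, φ ⊢ ψ)
  cut   : ∀ Γ φ ψ → PL ((Γ ⊢ φ) ∷ (Γ ,, φ ⊢ ψ) ∷ []) (Γ ⊢ ψ)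
  ∧E₁   : ∀ Γ φ ψ → PL ((Γ ⊢ φ ∧ ψ) ∷ []) (Γ ⊢ φ)
  ∧E₂   : ∀ Γ φ ψ → PL ((Γ ⊢ φ ∧ ψ) ∷ []) (Γ ⊢ ψ)
  ∧I    : ∀ Γ φ ψ → PL ((Γ ⊢ φ) ∷ (Γ ⊢ ψ) ∷ []) (Γ ⊢ φ ∧ ψ)
  ⇒E    : ∀ Γ φ ψ → PL ((Γ ⊢ φ) ∷ (Γ ⊢ φ ⇒ ψ) ∷ []) (Γ ⊢ ψ)
  ⇒K    : ∀ Γ φ ψ → PL ((Γ ⊢ ψ) ∷ []) (Γ ⊢ φ ⇒ ψ)

data ⇒IRule : Rules where
  ⇒I : ∀ Γ φ ψ → ⇒IRule ((Γ ,, φ ⊢ ψ) ∷ []) (Γ ⊢ φ ⇒ ψ)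

data ExFalso : Rules where
  ⊥E : ∀ φ → ExFalso [] ([ ⊥′ ] ⊢ φ)

data Cases : Rules where
  em : ∀ Γ φ ψ → Cases ((Γ ,, φ ⊢ ψ) ∷ (Γ ,, (φ ⇒ ⊥′) ⊢ ψ) ∷ []) (Γ ⊢ ψ)

ML IL CL : Rules
ML = PL ∪ ⇒IRule
IL = ML ∪ ExFalso
CL = IL ∪ Cases

data E1 : Rules where
  e1 : ∀ Γ φ ψ χ → E1 ((Γ ,, φ ⊢ ψ) ∷ (Γ ,, ψ ⊢ φ) ∷ []) (Γ ,, (φ ⇒ χ) ⊢ ψ ⇒ χ)

data E2 : Rules where
  e2 : ∀ Γ φ ψ χ → E2 ((Γ ,, φ ⊢ ψ) ∷ (Γ ,, ψ ⊢ φ) ∷ []) (Γ ,, (χ ⇒ φ) ⊢ χ ⇒ ψ)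

data E1₀ : Rules where
  e1₀ : ∀ φ ψ χ → E1₀ (([ φ ] ⊢ ψ) ∷ ([ ψ ] ⊢ φ) ∷ []) ([ φ ⇒ χ ] ⊢ ψ ⇒ χ)

data E2₀ : Rules where
  e2₀ : ∀ φ ψ χ → E2₀ (([ φ ] ⊢ ψ) ∷ ([ ψ ] ⊢ φ) ∷ []) ([ χ ⇒ φ ] ⊢ χ ⇒ ψ)

PEL PEL₀ : Rules
PEL  = (PL ∪ E1) ∪ E2
PEL₀ = (PL ∪ E1₀) ∪ E2₀

EqSubst : Rules → Set
EqSubst A = ∀ (F : Formula) (Γ : List Formula) (φ ψ : Formula) →
  Der A ((Γ ,, φ ⊢ ψ) ∷ (Γ ,, ψ ⊢ φ) ∷ []) (Γ ,, (F ⟦ φ ⟧) ⊢ F ⟦ ψ ⟧)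

WeakEqSubst : Rules → Set
WeakEqSubst A = ∀ (F : Formula) (φ ψ : Formula) →
  Der A (([ φ ] ⊢ ψ) ∷ ([ ψ ] ⊢ φ) ∷ []) ([ F ⟦ φ ⟧ ] ⊢ F ⟦ ψ ⟧)

{-# OPTIONS --safe #-}
-- Atoms other than x₀ are handled by the identity axiom and ∧ by
-- the PL rules for conjunction; for F ⇒ G one passes from F[φ] ⇒ G[φ] to
-- F[ψ] ⇒ G[φ] by E1 and then to F[ψ] ⇒ G[ψ] by E2, chaining the two with cut.
module Submission where

open import Defs
open import Data.Product using (_×_; _,_; proj₁; proj₂; swap)
open import Data.Nat using (zero; suc)
open import Data.List using (List; []; _∷_; _++_; [_])
open import Data.List.Properties using (++-assoc; ++-identityʳ)
open import Data.List.Membership.Propositional using (_∈_)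
open import Data.List.Membership.Propositional.Properties using (∈-++⁺ˡ; ∈-++⁺ʳ; ∈-++⁻)
open import Data.List.Relation.Binary.Subset.Propositional using (_⊆_)
open import Data.List.Relation.Unary.All as All using (All; []; _∷_)
open import Data.List.Relation.Unary.Any using (here; there)
open import Data.Sum using (inj₁; inj₂)
open import Relation.Binary.PropositionalEquality using (refl; subst; sym)

module _ {A : Rules} {H : List Sequent} where

  mutual
    Der-graft : ∀ {ps c} → Der A ps c → All (Der A H) ps → Der A H c
    Der-graft (hyp s∈ps)     ds = All.lookup ds s∈ps
    Der-graft (rule r es)    ds = rule r (All-graft es ds)
    Der-graft (struct s t d) ds = struct s t (Der-graft d ds)

    All-graft : ∀ {ps qs} → All (Der A ps) qs → All (Der A H) ps → All (Der A H) qs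
    All-graft []       ds = []
    All-graft (e ∷ es) ds = Der-graft e ds ∷ All-graft es ds

  derive : ∀ {R ps c} → R ≤L A → R ps c → All (Der A H) ps → Der A H c
  derive {R} {ps} {c} R≤A r = Der-graft (R≤A ps c r)

  _⊣⊢_within_ : Formula → Formula → List Formula → Set
  φ ⊣⊢ ψ within Γ = Der A H (Γ ,, φ ⊢ ψ) × Der A H (Γ ,, ψ ⊢ φ)

  module FromPL (PL≤A : PL ≤L A) where

    weaken-++ : ∀ {Δ a} E → Der A H (Δ ⊢ a) → Der A H (Δ ++ E ⊢ a)
    weaken-++ {Δ} {a} []      d = subst (λ Θ → Der A H (Θ ⊢ a)) (sym (++-identityʳ Δ)) d
    weaken-++ {Δ} {a} (x ∷ E) d =
      subst (λ Θ → Der A H (Θ ⊢ a)) (++-assoc Δ [ x ] E)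
        (weaken-++ E (derive PL≤A (weak Δ x a) (d ∷ [])))

    weaken-⊆ : ∀ {Δ Δ′ a} → Δ ⊆ Δ′ → Der A H (Δ ⊢ a) → Der A H (Δ′ ⊢ a)
    weaken-⊆ {Δ} {Δ′} Δ⊆Δ′ d = struct absorb (∈-++⁺ʳ Δ) (weaken-++ Δ′ d)
      where
      absorb : Δ ++ Δ′ ⊆ Δ′
      absorb x∈ with ∈-++⁻ Δ x∈
      ... | inj₁ x∈Δ  = Δ⊆Δ′ x∈Δ
      ... | inj₂ x∈Δ′ = x∈Δ′

    ∈-,,-last : ∀ Γ {a} → a ∈ Γ ,, a
    ∈-,,-last Γ = ∈-++⁺ʳ Γ (here refl)

    ,,-⊆-swap-last : ∀ Γ a b → Γ ,, a ⊆ Γ ,, b ,, a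
    ,,-⊆-swap-last Γ a b x∈ with ∈-++⁻ Γ x∈
    ... | inj₁ x∈Γ        = ∈-++⁺ˡ (∈-++⁺ˡ x∈Γ)
    ... | inj₂ (here refl) = ∈-,,-last (Γ ,, b)
    ... | inj₂ (there ())

    assumption : ∀ Γ a → Der A H (Γ ,, a ⊢ a)
    assumption Γ a =
      weaken-⊆ (λ { (here refl) → ∈-,,-last Γ ; (there ()) }) (derive PL≤A (ax a) [])

    ⊢-trans : ∀ Γ {a b c} → Der A H (Γ ,, a ⊢ b) → Der A H (Γ ,, b ⊢ c) → Der A H (Γ ,, a ⊢ c)
    ⊢-trans Γ {a} {b} {c} a⊢b b⊢c =
      derive PL≤A (cut (Γ ,, a) b c) (a⊢b ∷ weaken-⊆ (,,-⊆-swap-last Γ b a) b⊢c ∷ [])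

    ∧-mono : ∀ Γ {a a′ b b′} → Der A H (Γ ,, a ⊢ a′) → Der A H (Γ ,, b ⊢ b′)
           → Der A H (Γ ,, (a ∧ b) ⊢ a′ ∧ b′)
    ∧-mono Γ {a} {a′} {b} {b′} a⊢a′ b⊢b′ =
      derive PL≤A (∧I Δ a′ b′)
        ( derive PL≤A (cut Δ a a′)
            (derive PL≤A (∧E₁ Δ a b) (assumption Γ _ ∷ []) ∷ weaken-⊆ (,,-⊆-swap-last Γ a _) a⊢a′ ∷ [])
        ∷ derive PL≤A (cut Δ b b′)
            (derive PL≤A (∧E₂ Δ a b) (assumption Γ _ ∷ []) ∷ weaken-⊆ (,,-⊆-swap-last Γ b _) b⊢b′ ∷ [])
        ∷ [])
      where Δ = Γ ,, (a ∧ b)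

    module _ (Γ : List Formula)
      (⇒-resp-⊣⊢ˡ : ∀ {φ ψ} χ → φ ⊣⊢ ψ within Γ → Der A H (Γ ,, (φ ⇒ χ) ⊢ ψ ⇒ χ))
      (⇒-resp-⊣⊢ʳ : ∀ {φ ψ} χ → φ ⊣⊢ ψ within Γ → Der A H (Γ ,, (χ ⇒ φ) ⊢ χ ⇒ ψ))
      where

      ⇒-mono : ∀ {a a′ b b′} → a ⊣⊢ a′ within Γ → b ⊣⊢ b′ within Γ
             → Der A H (Γ ,, (a ⇒ b) ⊢ a′ ⇒ b′)
      ⇒-mono a⊣⊢a′ b⊣⊢b′ = ⊢-trans Γ (⇒-resp-⊣⊢ˡ _ a⊣⊢a′) (⇒-resp-⊣⊢ʳ _ b⊣⊢b′)

      ⟦⟧-resp-⊣⊢ : ∀ F {φ ψ} → φ ⊣⊢ ψ within Γ → (F ⟦ φ ⟧) ⊣⊢ (F ⟦ ψ ⟧) within Γ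
      ⟦⟧-resp-⊣⊢ (var zero)    φ⊣⊢ψ = φ⊣⊢ψ
      ⟦⟧-resp-⊣⊢ (var (suc n)) _    = assumption Γ _ , assumption Γ _
      ⟦⟧-resp-⊣⊢ ⊤′            _    = assumption Γ _ , assumption Γ _
      ⟦⟧-resp-⊣⊢ ⊥′            _    = assumption Γ _ , assumption Γ _
      ⟦⟧-resp-⊣⊢ (F ∧ G) φ⊣⊢ψ =
        ∧-mono Γ (proj₁ F⊣⊢) (proj₁ G⊣⊢) , ∧-mono Γ (proj₂ F⊣⊢) (proj₂ G⊣⊢)
        where
        F⊣⊢ = ⟦⟧-resp-⊣⊢ F φ⊣⊢ψ
        G⊣⊢ = ⟦⟧-resp-⊣⊢ G φ⊣⊢ψ
      ⟦⟧-resp-⊣⊢ (F ⇒ G) φ⊣⊢ψ =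
        ⇒-mono F⊣⊢ G⊣⊢ , ⇒-mono (swap F⊣⊢) (swap G⊣⊢)
        where
        F⊣⊢ = ⟦⟧-resp-⊣⊢ F φ⊣⊢ψ
        G⊣⊢ = ⟦⟧-resp-⊣⊢ G φ⊣⊢ψ

lemma3p1 : ((A : Rules) → PEL₀ ≤L A → A ≤L CL → WeakEqSubst A)
    × ((A : Rules) → PEL ≤L A → A ≤L CL → EqSubst A)
lemma3p1 = weak-form , full-form
  where
  weak-form : (A : Rules) → PEL₀ ≤L A → A ≤L CL → WeakEqSubst A
  weak-form A PEL₀≤A _ F φ ψ =
    proj₁ (⟦⟧-resp-⊣⊢ [] (λ χ (p , q) → derive PEL₀≤A (inj₁ (inj₂ (e1₀ _ _ χ))) (p ∷ q ∷ []))
                         (λ χ (p , q) → derive PEL₀≤A (inj₂ (e2₀ _ _ χ)) (p ∷ q ∷ []))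
                         F (hyp (here refl) , hyp (there (here refl))))
    where open FromPL {A} (λ ps c r → PEL₀≤A ps c (inj₁ (inj₁ r)))

  full-form : (A : Rules) → PEL ≤L A → A ≤L CL → EqSubst A
  full-form A PEL≤A _ F Γ φ ψ =
    proj₁ (⟦⟧-resp-⊣⊢ Γ (λ χ (p , q) → derive PEL≤A (inj₁ (inj₂ (e1 Γ _ _ χ))) (p ∷ q ∷ []))
                        (λ χ (p , q) → derive PEL≤A (inj₂ (e2 Γ _ _ χ)) (p ∷ q ∷ []))
                        F (hyp (here refl) , hyp (there (here refl))))
    where open FromPL {A} (λ ps c r → PEL≤A ps c (inj₁ (inj₁ r)))
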